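{- Let $\mathcal{A}$ be a finite alphabet of modalities, $I=(Y,(S_\Diamond)_{\Diamond\in\mathcal{A}})$ an $\mathcal{A}$-frame in which every $S_\Diamond$ is irreflexive, and $(F_i)_{i\in Y}$ a family of $\mathcal{A}$-frames. If the complex algebras $\mathrm{Alg}(\bigsqcup_{i\in Y}F_i)$ and $\mathrm{Alg}(I)$ are locally finite, then $\mathrm{Alg}(\sum_I F_i)$ is locally finite, and hence the logic of $\sum_I F_i$ has the finite model property.
   Context: For $F_i=(X_i,(R_{i,\Diamond})_{\Diamond\in\mathcal{A}})$, the disjoint sum $\bigsqcup_{i\in Y}F_i$ has domain $\bigcup_{i\in Y}\{i\}\times X_i$ with $(i,a)R_\Diamond(j,b)$ iff $i=j$ and $aR_{i,\Diamond}b$. The sum $\sum_I F_i$ has the same domain and relations $(i,a)R^\Sigma_\Diamond(j,b)$ iff ($i=j$ and $aR_{i,\Diamond}b$) or ($i\ne j$ and $iS_\Diamond j$). The complex algebra $\mathrm{Alg}(H)$ of a frame $H=(Z,(T_\Diamond)_\Diamond)$ is the powerset Boolean algebra of $Z$ with operations $f_\Diamond(W)=T_\Diamond^{ -1}[W]$. An algebra is locally finite if every finitely generated subalgebra is finite. A logic has the finite model property if it is the logic (set of valid formulas) of some class of finite frames. -}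

module Defs where

open import Data.Nat using (ℕ)
open import Data.Fin using (Fin)
open import Data.Product using (Σ; Σ-syntax; ∃; _×_; _,_)
open import Data.Sum using (_⊎_)
open import Data.Empty using (⊥)
open import Data.Unit using (⊤)
open import Data.List using (List)
open import Data.List.Relation.Unary.Any using (Any)
open import Relation.Nullary using (¬_; Dec)
open import Relation.Binary.PropositionalEquality using (_≡_)

LEM : Set₁
LEM = (P : Set) → Dec P

record Frame (k : ℕ) : Set₁ where
  constructor frame
  field
    Carrier : Set
    Rel     : Fin k → Carrier → Carrier → Set
open Frame public

Pred : Set → Set₁
Pred Z = Z → Set

_≐_ : {Z : Set} → Pred Z → Pred Z → Set
A ≐ B = ∀ z → (A z → B z) × (B z → A z)

Irreflexive : {Z : Set} → (Z → Z → Set) → Set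
Irreflexive R = ∀ z → ¬ R z z

data DisjRel {k : ℕ} {Y : Set} (F : Y → Frame k) (d : Fin k) :
     Σ Y (λ i → Carrier (F i)) → Σ Y (λ i → Carrier (F i)) → Set where
  inside : ∀ {i a b} → Rel (F i) d a b → DisjRel F d (i , a) (i , b)

DisjSum : {k : ℕ} (Y : Set) → (Y → Frame k) → Frame k
DisjSum Y F = frame (Σ Y (λ i → Carrier (F i))) (DisjRel F)

data SumRel {k : ℕ} (I : Frame k) (F : Carrier I → Frame k) (d : Fin k) :
     Σ (Carrier I) (λ i → Carrier (F i)) → Σ (Carrier I) (λ i → Carrier (F i)) → Set where
  inside  : ∀ {i a b} → Rel (F i) d a b → SumRel I F d (i , a) (i , b)
  between : ∀ {i j a b} → ¬ (i ≡ j) → Rel I d i j → SumRel I F d (i , a) (j , b)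

Sum : {k : ℕ} (I : Frame k) → (Carrier I → Frame k) → Frame k
Sum I F = frame (Σ (Carrier I) (λ i → Carrier (F i))) (SumRel I F)

data Term (k n : ℕ) : Set where
  var  : Fin n → Term k n
  bot  : Term k n
  top  : Term k n
  neg  : Term k n → Term k n
  meet : Term k n → Term k n → Term k n
  join : Term k n → Term k n → Term k n
  dia  : Fin k → Term k n → Term k n

-- Complex algebra Alg(H): powerset of the carrier, f_◇(W) = T_◇^{-1}[W].
fDia : {k : ℕ} (H : Frame k) → Fin k → Pred (Carrier H) → Pred (Carrier H)
fDia H d W z = ∃ λ w → Rel H d z w × W w

evalAlg : {k n : ℕ} (H : Frame k) → (Fin n → Pred (Carrier H)) → Term k n → Pred (Carrier H)
evalAlg H g (var x)    = g x
evalAlg H g bot        = λ _ → ⊥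
evalAlg H g top        = λ _ → ⊤
evalAlg H g (neg t)    = λ z → ¬ evalAlg H g t z
evalAlg H g (meet s t) = λ z → evalAlg H g s z × evalAlg H g t z
evalAlg H g (join s t) = λ z → evalAlg H g s z ⊎ evalAlg H g t z
evalAlg H g (dia d t)  = fDia H d (evalAlg H g t)

-- Alg(H) is locally finite: the subalgebra generated by any finite family of
-- elements g (= set of values of terms in g) is finite, i.e. contained (up to
-- equality of subsets) in a finite list.
LocallyFiniteAlg : {k : ℕ} → Frame k → Set₁
LocallyFiniteAlg H =
  (n : ℕ) (g : Fin n → Pred (Carrier H)) →
  Σ (List (Pred (Carrier H))) λ L → (t : Term _ n) → Any (λ A → A ≐ evalAlg H g t) L

data Fm (k : ℕ) : Set where
  pvar : ℕ → Fm k
  fbot : Fm k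
  _⇒_  : Fm k → Fm k → Fm k
  ◇    : Fin k → Fm k → Fm k

_,_⊨_at_ : {k : ℕ} (H : Frame k) → (ℕ → Pred (Carrier H)) → Fm k → Carrier H → Set
H , V ⊨ pvar p at z = V p z
H , V ⊨ fbot at z = ⊥
H , V ⊨ (φ ⇒ ψ) at z = H , V ⊨ φ at z → H , V ⊨ ψ at z
H , V ⊨ ◇ d φ at z = ∃ λ w → Rel H d z w × H , V ⊨ φ at w

Valid : {k : ℕ} → Frame k → Fm k → Set₁
Valid H φ = (V : ℕ → Pred (Carrier H)) (z : Carrier H) → H , V ⊨ φ at z

FinFrame : ℕ → Set₁
FinFrame k = Σ ℕ λ m → (Fin k → Fin m → Fin m → Set)

toFrame : {k : ℕ} → FinFrame k → Frame k
toFrame (m , R) = frame (Fin m) R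

FMP : {k : ℕ} → Frame k → Set₂
FMP {k} H = Σ (FinFrame k → Set₁) λ C →
  (φ : Fm k) → (Valid H φ → (G : FinFrame k) → C G → Valid (toFrame G) φ)
             × (((G : FinFrame k) → C G → Valid (toFrame G) φ) → Valid H φ)

-- Fix generators g of a subalgebra of Alg(∑_I F_i). Every element of it is glued from finitely
-- many pieces: on a fibre {i} × X_i it is cut out by an element of the (finite) subalgebra of
-- Alg(⨆ F_i) generated by g, chosen according to the type of i in the finite subalgebra of Alg(I)
-- generated by the sets of indices whose fibre meets one of those elements. Glued sets are closed
-- under the Boolean operations and under ◇: the part of R^Σ leaving the fibre of i contributes
-- i ∈ ◇_I {j | the fibre of j is inhabited}, which depends only on the type of i (irreflexivity
-- of S_◇ is what lets i S_◇ j stand in for i ≠ j ∧ i S_◇ j). There are finitely many glued sets.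
--
-- Local finiteness gives the finite model property by filtration: the types of points with respect
-- to the finite subalgebra generated by the valuation of a formula form a finite frame onto which
-- the original frame maps by a surjective bounded morphism, so it validates the logic and still
-- refutes the formula.

module Submission where

open import Defs
open import Axiom.UniquenessOfIdentityProofs using (module Decidable⇒UIP)
open import Data.Empty using (⊥-elim)
open import Data.Fin using (Fin; zero; suc; funToFin; finToFun; combine; _≟_)
open import Data.Fin.Patterns using (0F; 1F)
open import Data.Fin.Properties using (finToFun-funToFin; funToFin-finToFin)
open import Data.List using (List; []; _∷_; _++_; length; lookup; filter; allFin; mapMaybe; map)
open import Data.List.Membership.Propositional using (_∈_)
open import Data.List.Membership.Propositional.Properties using (∈-allFin; ∈-filter⁺; ∈-filter⁻; ∈-lookup)
open import Data.List.Membership.Setoid.Properties using (unique⇒irrelevant)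
open import Data.List.Relation.Unary.Any as Any using (Any; here)
open import Data.List.Relation.Unary.Any.Properties using (lookup-index; map⁺; mapMaybe⁺; ++⁺ˡ; ++⁺ʳ)
open import Data.List.Relation.Unary.Unique.Propositional.Properties using (allFin⁺; filter⁺)
open import Data.Maybe using (Maybe)
open import Relation.Nullary.Decidable using (dec⇒maybe)
import Data.Maybe as Maybe
import Data.Maybe.Relation.Unary.Any as MaybeAny
open import Data.Nat using (ℕ; _^_)
open import Data.Product using (Σ; ∃; _×_; _,_; proj₁; proj₂)
import Data.Product as Product
open import Data.Sum using (_⊎_; inj₁; inj₂)
import Data.Sum as Sum
open import Data.Unit using (tt)
open import Function using (_∘_)
open import Relation.Binary.PropositionalEquality using (_≡_; refl; sym; trans; cong; cong₂; subst; setoid)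
open import Relation.Nullary using (¬_; Dec; yes; no; contradiction)
open import Relation.Unary using (Decidable)

infix 0 _⇔_

_⇔_ : Set → Set → Set
A ⇔ B = (A → B) × (B → A)

⇔-refl : {A : Set} → A ⇔ A
⇔-refl = (λ a → a) , (λ a → a)

⇔-sym : {A B : Set} → A ⇔ B → B ⇔ A
⇔-sym (f , g) = g , f

⇔-trans : {A B C : Set} → A ⇔ B → B ⇔ C → A ⇔ C
⇔-trans (f , f′) (g , g′) = g ∘ f , f′ ∘ g′

¬-cong : {A B : Set} → A ⇔ B → ¬ A ⇔ ¬ B
¬-cong (f , g) = (λ ¬a → ¬a ∘ g) , (λ ¬b → ¬b ∘ f)

×-cong : {A B C D : Set} → A ⇔ B → C ⇔ D → A × C ⇔ B × D
×-cong (f , f′) (g , g′) = Product.map f g , Product.map f′ g′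

⊎-cong : {A B C D : Set} → A ⇔ B → C ⇔ D → A ⊎ C ⇔ B ⊎ D
⊎-cong (f , f′) (g , g′) = Sum.map f g , Sum.map f′ g′

→-cong : {A B C D : Set} → A ⇔ B → C ⇔ D → (A → C) ⇔ (B → D)
→-cong (f , f′) (g , g′) = (λ h → g ∘ h ∘ f′) , (λ h → g′ ∘ h ∘ f)

∃-cong : {A : Set} {P Q : A → Set} → (∀ x → P x ⇔ Q x) → ∃ P ⇔ ∃ Q
∃-cong P⇔Q = Product.map₂ (proj₁ (P⇔Q _)) , Product.map₂ (proj₂ (P⇔Q _))

≐-refl : {Z : Set} {A : Pred Z} → A ≐ A
≐-refl z = ⇔-refl

≐-reflexive : {Z : Set} {A B : Pred Z} → A ≡ B → A ≐ B
≐-reflexive refl = ≐-refl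

≐-sym : {Z : Set} {A B : Pred Z} → A ≐ B → B ≐ A
≐-sym A≐B z = ⇔-sym (A≐B z)

≐-trans : {Z : Set} {A B C : Pred Z} → A ≐ B → B ≐ C → A ≐ C
≐-trans A≐B B≐C z = ⇔-trans (A≐B z) (B≐C z)

record Enumeration {n : ℕ} (P : Fin n → Set) : Set where
  field
    size       : ℕ
    elem       : Fin size → Fin n
    elem-sat   : ∀ i → P (elem i)
    index      : ∀ x → P x → Fin size
    elem-index : ∀ x p → elem (index x p) ≡ x
    index-elem : ∀ i p → index (elem i) p ≡ i

  index-unique : ∀ {x} p i → x ≡ elem i → index x p ≡ i
  index-unique p i refl = index-elem i p

index-∈-lookup : {A : Set} (xs : List A) (i : Fin (length xs)) → Any.index (∈-lookup {xs = xs} i) ≡ i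
index-∈-lookup (x ∷ xs) zero    = refl
index-∈-lookup (x ∷ xs) (suc i) = cong suc (index-∈-lookup xs i)

enumerate : {n : ℕ} {P : Fin n → Set} → Decidable P → Enumeration P
enumerate {n} {P} P? = record
  { size       = length xs
  ; elem       = lookup xs
  ; elem-sat   = λ i → proj₂ (∈-filter⁻ P? {xs = allFin n} (∈-lookup i))
  ; index      = λ x p → Any.index (member x p)
  ; elem-index = λ x p → sym (lookup-index (member x p))
  ; index-elem = λ i p → trans (cong Any.index (membership-unique (member _ p) (∈-lookup i)))
                               (index-∈-lookup xs i)
  }
  where
  xs : List (Fin n)
  xs = filter P? (allFin n)
  member : ∀ x → P x → x ∈ xs
  member x p = ∈-filter⁺ P? (∈-allFin x) p
  membership-unique : ∀ {x} (m m′ : x ∈ xs) → m ≡ m′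
  membership-unique = unique⇒irrelevant (setoid (Fin n)) (Decidable⇒UIP.≡-irrelevant _≟_)
                                        (filter⁺ P? (allFin⁺ n))

funToFin-cong : {m n : ℕ} {f f′ : Fin m → Fin n} → (∀ i → f i ≡ f′ i) → funToFin f ≡ funToFin f′
funToFin-cong {ℕ.zero}  f≗f′ = refl
funToFin-cong {ℕ.suc m} f≗f′ = cong₂ combine (f≗f′ zero) (funToFin-cong (f≗f′ ∘ suc))

⋀ : {k n m : ℕ} → (Fin m → Term k n) → Term k n
⋀ {m = ℕ.zero}  f = top
⋀ {m = ℕ.suc m} f = meet (f zero) (⋀ (f ∘ suc))

⋁ : {k n m : ℕ} → (Fin m → Term k n) → Term k n
⋁ {m = ℕ.zero}  f = bot
⋁ {m = ℕ.suc m} f = join (f zero) (⋁ (f ∘ suc))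

decTerm : {k n : ℕ} {A : Set} → Dec A → Term k n
decTerm (yes _) = top
decTerm (no _)  = bot

fDia-cong : {k : ℕ} (H : Frame k) → ∀ d {W W′ : Pred (Carrier H)} → W ≐ W′ → fDia H d W ≐ fDia H d W′
fDia-cong H d W≐W′ z = ∃-cong (λ w → ×-cong ⇔-refl (W≐W′ w))

module _ {k : ℕ} (H : Frame k) {n : ℕ} (g : Fin n → Pred (Carrier H)) where

  evalAlg-⋀ : {m : ℕ} (f : Fin m → Term k n) (z : Carrier H) →
              evalAlg H g (⋀ f) z ⇔ (∀ l → evalAlg H g (f l) z)
  evalAlg-⋀ {ℕ.zero}  f z = (λ _ ()) , (λ _ → tt)
  evalAlg-⋀ {ℕ.suc m} f z =
    (λ { (f₀ , fₛ) → λ { zero → f₀ ; (suc l) → proj₁ (evalAlg-⋀ (f ∘ suc) z) fₛ l } }) ,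
    (λ all → all zero , proj₂ (evalAlg-⋀ (f ∘ suc) z) (all ∘ suc))

  evalAlg-⋁ : {m : ℕ} (f : Fin m → Term k n) (z : Carrier H) →
              evalAlg H g (⋁ f) z ⇔ ∃ λ l → evalAlg H g (f l) z
  evalAlg-⋁ {ℕ.zero}  f z = (λ ()) , (λ { (() , _) })
  evalAlg-⋁ {ℕ.suc m} f z =
    (λ { (inj₁ f₀) → zero , f₀
       ; (inj₂ fₛ) → let l , fₗ = proj₁ (evalAlg-⋁ (f ∘ suc) z) fₛ in suc l , fₗ }) ,
    (λ { (zero , f₀) → inj₁ f₀ ; (suc l , fₗ) → inj₂ (proj₂ (evalAlg-⋁ (f ∘ suc) z) (l , fₗ)) })

  evalAlg-decTerm : {A : Set} (x : Dec A) (z : Carrier H) → evalAlg H g (decTerm x) z ⇔ A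
  evalAlg-decTerm (yes a) z = (λ _ → a) , (λ _ → tt)
  evalAlg-decTerm (no ¬a) z = (λ ()) , ¬a

  record TermCover : Set where
    field
      size   : ℕ
      term   : Fin size → Term k n
      covers : ∀ t → ∃ λ l → evalAlg H g (term l) ≐ evalAlg H g t

  module _ (lem : LEM) where

    definingTerm : Pred (Carrier H) → Maybe (Term k n)
    definingTerm A = Maybe.map proj₁ (dec⇒maybe (lem (∃ λ s → A ≐ evalAlg H g s)))

    definingTerm-complete : ∀ {A} t → A ≐ evalAlg H g t →
                            MaybeAny.Any (λ s → evalAlg H g s ≐ evalAlg H g t) (definingTerm A)
    definingTerm-complete {A} t A≐t with lem (∃ λ s → A ≐ evalAlg H g s)
    ... | yes (s , A≐s) = MaybeAny.just (≐-trans (≐-sym A≐s) A≐t)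
    ... | no ∄s         = contradiction (t , A≐t) ∄s

    termCover : (Σ (List (Pred (Carrier H))) λ As → ∀ t → Any (λ A → A ≐ evalAlg H g t) As) → TermCover
    termCover (As , cover) = record
      { size   = length terms
      ; term   = lookup terms
      ; covers = λ t → let t∈ = found t in Any.index t∈ , lookup-index t∈
      }
      where
      terms : List (Term k n)
      terms = mapMaybe definingTerm As
      found : ∀ t → Any (λ s → evalAlg H g s ≐ evalAlg H g t) terms
      found t = mapMaybe⁺ definingTerm As (map⁺ (Any.map (definingTerm-complete t) (cover t)))

module Types (lem : LEM) {k : ℕ} (H : Frame k) {n : ℕ} {g : Fin n → Pred (Carrier H)}
             (C : TermCover H g) where
  open TermCover C

  Code : Set
  Code = Fin (2 ^ size)

  literal : Term k n → Fin 2 → Term k n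
  literal t 0F = neg t
  literal t 1F = t

  bit : Term k n → Carrier H → Fin 2
  bit t z with lem (evalAlg H g t z)
  ... | yes _ = 1F
  ... | no  _ = 0F

  literal-bit : ∀ t z → evalAlg H g (literal t (bit t z)) z
  literal-bit t z with lem (evalAlg H g t z)
  ... | yes p = p
  ... | no ¬p = ¬p

  bit-literal : ∀ t b z → evalAlg H g (literal t b) z → bit t z ≡ b
  bit-literal t 0F z ¬p with lem (evalAlg H g t z)
  ... | yes p = ⊥-elim (¬p p)
  ... | no _  = refl
  bit-literal t 1F z p with lem (evalAlg H g t z)
  ... | yes _ = refl
  ... | no ¬p = ⊥-elim (¬p p)

  type : Carrier H → Fin size → Fin 2
  type z l = bit (term l) z

  code : Carrier H → Code
  code z = funToFin (type z)

  atom : Code → Term k n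
  atom c = ⋀ λ l → literal (term l) (finToFun c l)

  atom-correct : ∀ c z → evalAlg H g (atom c) z ⇔ code z ≡ c
  atom-correct c z = code≡ ∘ proj₁ (evalAlg-⋀ H g _ z) , proj₂ (evalAlg-⋀ H g _ z) ∘ literals
    where
    code≡ : (∀ l → evalAlg H g (literal (term l) (finToFun c l)) z) → code z ≡ c
    code≡ lits = trans (funToFin-cong (λ l → bit-literal (term l) (finToFun c l) z (lits l)))
                       (funToFin-finToFin {size} c)
    literals : code z ≡ c → ∀ l → evalAlg H g (literal (term l) (finToFun c l)) z
    literals refl l = subst (λ b → evalAlg H g (literal (term l) b) z)
                            (sym (finToFun-funToFin (type z) l)) (literal-bit (term l) z)

  same-code-agree : ∀ {z z′} → code z ≡ code z′ → ∀ t → evalAlg H g t z → evalAlg H g t z′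
  same-code-agree {z} {z′} z≡z′ t tz =
    proj₁ (t≐ z′) (subst (λ b → evalAlg H g (literal (term l) b) z′) bit≡1 lit)
    where
    l : Fin size
    l = proj₁ (covers t)
    t≐ : evalAlg H g (term l) ≐ evalAlg H g t
    t≐ = proj₂ (covers t)
    bit≡1 : finToFun (code z) l ≡ 1F
    bit≡1 = trans (finToFun-funToFin (type z) l) (bit-literal (term l) 1F z (proj₂ (t≐ z) tz))
    lit : evalAlg H g (literal (term l) (finToFun (code z) l)) z′
    lit = proj₁ (evalAlg-⋀ H g _ z′) (proj₂ (atom-correct (code z) z′) (sym z≡z′)) l

  code-invariant : ∀ t z → (∃ λ z′ → code z′ ≡ code z × evalAlg H g t z′) ⇔ evalAlg H g t z
  code-invariant t z =
    (λ { (z′ , z′≡z , tz′) → same-code-agree z′≡z t tz′ }) , (λ tz → z , refl , tz)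

  select : (Code → Term k n) → Term k n
  select f = ⋁ λ c → meet (atom c) (f c)

  select-correct : ∀ f z → evalAlg H g (select f) z ⇔ evalAlg H g (f (code z)) z
  select-correct f z = ⇔-trans (evalAlg-⋁ H g _ z)
    ( (λ { (c , atom-c , fc) → subst (λ c → evalAlg H g (f c) z) (sym (proj₁ (atom-correct c z) atom-c)) fc })
    , (λ fz → code z , proj₂ (atom-correct (code z) z) refl , fz) )

record BoundedMorphism {k : ℕ} (H G : Frame k) : Set where
  field
    to    : Carrier H → Carrier G
    forth : ∀ {d z w} → Rel H d z w → Rel G d (to z) (to w)
    back  : ∀ {d z x} → Rel G d (to z) x → ∃ λ w → Rel H d z w × to w ≡ x

  truth : (U : ℕ → Pred (Carrier G)) → ∀ φ z → (H , (λ p → U p ∘ to) ⊨ φ at z) ⇔ (G , U ⊨ φ at to z)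
  truth U (pvar p) z = ⇔-refl
  truth U fbot     z = ⇔-refl
  truth U (φ ⇒ ψ)  z = →-cong (truth U φ z) (truth U ψ z)
  truth U (◇ d φ)  z =
    (λ { (w , r , φw) → to w , forth r , proj₁ (truth U φ w) φw }) ,
    (λ { (x , r , φx) → let w , rw , w↦x = back r in
                        w , rw , proj₂ (truth U φ w) (subst (λ x → G , U ⊨ φ at x) (sym w↦x) φx) })

  surjective-preserves-validity : (∀ x → ∃ λ z → to z ≡ x) → ∀ φ → Valid H φ → Valid G φ
  surjective-preserves-validity onto φ valid U x =
    let z , z↦x = onto x in subst (λ x → G , U ⊨ φ at x) z↦x (proj₁ (truth U φ z) (valid _ z))

module Filtration (lem : LEM) {k : ℕ} (H : Frame k) {n : ℕ} {g : Fin n → Pred (Carrier H)}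
                  (C : TermCover H g) where
  open Types lem H C public

  realized : Code → Set
  realized c = ∃ λ z → code z ≡ c

  open Enumeration (enumerate (λ c → lem (realized c)))
    public using (elem; elem-sat; index; elem-index; index-unique) renaming (size to classes)

  rep : Fin classes → Carrier H
  rep i = proj₁ (elem-sat i)

  class : Carrier H → Fin classes
  class z = index (code z) (z , refl)

  code-class : ∀ z → elem (class z) ≡ code z
  code-class z = elem-index (code z) (z , refl)

  code-rep-class : ∀ z → code (rep (class z)) ≡ code z
  code-rep-class z = trans (proj₂ (elem-sat (class z))) (code-class z)

  class-rep : ∀ i → class (rep i) ≡ i
  class-rep i = index-unique (rep i , refl) i (proj₂ (elem-sat i))

  finiteFrame : FinFrame k
  finiteFrame = classes , λ d i j → fDia H d (evalAlg H g (atom (elem j))) (rep i)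

  quotient : BoundedMorphism H (toFrame finiteFrame)
  quotient = record { to = class ; forth = forth ; back = back }
    where
    forth : ∀ {d z w} → Rel H d z w → fDia H d (evalAlg H g (atom (elem (class w)))) (rep (class z))
    forth {d} {z} {w} r = same-code-agree (sym (code-rep-class z)) (dia d (atom (elem (class w))))
                            (w , r , proj₂ (atom-correct _ w) (sym (code-class w)))
    back : ∀ {d z j} → fDia H d (evalAlg H g (atom (elem j))) (rep (class z)) →
           ∃ λ w → Rel H d z w × class w ≡ j
    back {d} {z} {j} x = let w , r , atom-w = same-code-agree (code-rep-class z) (dia d (atom (elem j))) x in
                         w , r , index-unique (w , refl) j (proj₁ (atom-correct (elem j) w) atom-w)

vars : {k : ℕ} → Fm k → List ℕ
vars (pvar p) = p ∷ []
vars fbot     = []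
vars (φ ⇒ ψ)  = vars φ ++ vars ψ
vars (◇ d φ)  = vars φ

⊨-cong : {k : ℕ} (H : Frame k) {V V′ : ℕ → Pred (Carrier H)} →
         ∀ φ → (∀ {p} → p ∈ vars φ → V p ≐ V′ p) →
         ∀ z → (H , V ⊨ φ at z) ⇔ (H , V′ ⊨ φ at z)
⊨-cong H (pvar p) V≐V′ z = V≐V′ (here refl) z
⊨-cong H fbot     V≐V′ z = ⇔-refl
⊨-cong H (φ ⇒ ψ)  V≐V′ z =
  →-cong (⊨-cong H φ (V≐V′ ∘ ++⁺ˡ) z) (⊨-cong H ψ (V≐V′ ∘ ++⁺ʳ (vars φ)) z)
⊨-cong H (◇ d φ)  V≐V′ z = fDia-cong H d (⊨-cong H φ V≐V′) z

FrameOfLogic : {k : ℕ} → Frame k → FinFrame k → Set₁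
FrameOfLogic H G = ∀ φ → Valid H φ → Valid (toFrame G) φ

locallyFinite⇒fmp : LEM → {k : ℕ} (H : Frame k) → LocallyFiniteAlg H → FMP H
locallyFinite⇒fmp lem H lf = FrameOfLogic H , λ φ → (λ valid G G⊨H → G⊨H φ valid) , complete φ
  where
  complete : ∀ φ → (∀ G → FrameOfLogic H G → Valid (toFrame G) φ) → Valid H φ
  complete φ validInFinite V z =
    proj₂ (⊨-cong H φ V≐V∘rep∘class z)
          (proj₂ (truth U φ z) (validInFinite finiteFrame frameOfLogic U (class z)))
    where
    g : Fin (length (vars φ)) → Pred (Carrier H)
    g i = V (lookup (vars φ) i)
    open Filtration lem H (termCover H g lem (lf _ g))
    open BoundedMorphism quotient using (truth; surjective-preserves-validity)
    frameOfLogic : FrameOfLogic H finiteFrame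
    frameOfLogic = surjective-preserves-validity (λ i → rep i , class-rep i)
    U : ℕ → Pred (Fin classes)
    U p i = V p (rep i)
    V≐V∘rep∘class : ∀ {p} → p ∈ vars φ → V p ≐ (λ z → V p (rep (class z)))
    V≐V∘rep∘class {p} p∈φ z = transfer (sym (code-rep-class z)) , transfer (code-rep-class z)
      where
      transfer : ∀ {z z′} → code z ≡ code z′ → V p z → V p z′
      transfer {z} {z′} z≡z′ = subst (λ q → V q z → V q z′) (sym (lookup-index p∈φ))
                                     (same-code-agree z≡z′ (var (Any.index p∈φ)))

fDia-DisjSum : {k : ℕ} {Y : Set} (F : Y → Frame k) → ∀ d (W : Pred (Σ Y (Carrier ∘ F))) i a →
               fDia (DisjSum Y F) d W (i , a) ⇔ fDia (F i) d (λ b → W (i , b)) a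
fDia-DisjSum F d W i a = (λ { (_ , inside r , w) → _ , r , w }) , (λ { (b , r , w) → (i , b) , inside r , w })

fDia-Sum : {k : ℕ} (I : Frame k) → (∀ d → Irreflexive (Rel I d)) → (F : Carrier I → Frame k) →
           ∀ d (W : Pred (Σ (Carrier I) (Carrier ∘ F))) i a →
           fDia (Sum I F) d W (i , a) ⇔
             fDia (F i) d (λ b → W (i , b)) a ⊎ fDia I d (λ j → ∃ λ b → W (j , b)) i
fDia-Sum I irr F d W i a =
  (λ { (_ , inside r , w) → inj₁ (_ , r , w) ; ((j , b) , between _ r , w) → inj₂ (j , r , b , w) }) ,
  (λ { (inj₁ (b , r , w)) → (i , b) , inside r , w
     ; (inj₂ (j , r , b , w)) → (j , b) , between (λ { refl → irr d i r }) r , w })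

module SumLocallyFinite (lem : LEM) {k : ℕ} (I : Frame k) (irr : ∀ d → Irreflexive (Rel I d))
                        (F : Carrier I → Frame k) {n : ℕ} {g : Fin n → Pred (Carrier (Sum I F))}
                        (coverD : TermCover (DisjSum (Carrier I) F) g) (lfI : LocallyFiniteAlg I) where
  D S : Frame k
  D = DisjSum (Carrier I) F
  S = Sum I F
  open TermCover coverD renaming (size to p; term to dterm; covers to dcovers)

  nf : Term k n → Fin p
  nf t = proj₁ (dcovers t)

  inhabited : Fin p → Pred (Carrier I)
  inhabited j i = ∃ λ a → evalAlg D g (dterm j) (i , a)

  open Types lem I (termCover I inhabited lem (lfI p inhabited))

  glue : (Code → Term k n) → Pred (Carrier S)
  glue s (i , a) = evalAlg D g (s (code i)) (i , a)

  glue-cong : ∀ s s′ → (∀ c → evalAlg D g (s c) ≐ evalAlg D g (s′ c)) → glue s ≐ glue s′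
  glue-cong s s′ s≐s′ (i , a) = s≐s′ (code i) (i , a)

  fiberInhabited : (Code → Term k n) → Term k p
  fiberInhabited s = select (var ∘ nf ∘ s)

  fiberInhabited-correct : ∀ s j → evalAlg I inhabited (fiberInhabited s) j ⇔ ∃ λ b → glue s (j , b)
  fiberInhabited-correct s j =
    ⇔-trans (select-correct _ j) (∃-cong λ b → proj₂ (dcovers (s (code j))) (j , b))

  SeesInhabitedFiber : Fin k → (Code → Term k n) → Code → Set
  SeesInhabitedFiber d s c = ∃ λ i → code i ≡ c × evalAlg I inhabited (dia d (fiberInhabited s)) i

  glueDia : Fin k → (Code → Term k n) → Code → Term k n
  glueDia d s c = join (dia d (s c)) (decTerm (lem (SeesInhabitedFiber d s c)))

  glue-dia : ∀ d s {A} → glue s ≐ A → glue (glueDia d s) ≐ fDia S d A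
  glue-dia d s {A} s≐A (i , a) = ⇔-trans (⊎-cong inside-part between-part) (⇔-sym (fDia-Sum I irr F d A i a))
    where
    inside-part : fDia D d (evalAlg D g (s (code i))) (i , a) ⇔ fDia (F i) d (λ b → A (i , b)) a
    inside-part = ⇔-trans (fDia-DisjSum F d _ i a) (fDia-cong (F i) d (λ b → s≐A (i , b)) a)
    between-part : evalAlg D g (decTerm (lem (SeesInhabitedFiber d s (code i)))) (i , a) ⇔
                   fDia I d (λ j → ∃ λ b → A (j , b)) i
    between-part = ⇔-trans (evalAlg-decTerm D g (lem (SeesInhabitedFiber d s (code i))) (i , a))
                     (⇔-trans (code-invariant (dia d (fiberInhabited s)) i)
                     (fDia-cong I d (λ j → ⇔-trans (fiberInhabited-correct s j) (∃-cong λ b → s≐A (j , b)))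
                                i))

  glued : ∀ t → ∃ λ s → glue s ≐ evalAlg S g t
  glued (var x)    = (λ _ → var x) , ≐-refl
  glued bot        = (λ _ → bot) , ≐-refl
  glued top        = (λ _ → top) , ≐-refl
  glued (neg t)    = let s , s≐t = glued t in neg ∘ s , λ z → ¬-cong (s≐t z)
  glued (meet t u) = let s , s≐t = glued t ; s′ , s′≐u = glued u in
                     (λ c → meet (s c) (s′ c)) , λ z → ×-cong (s≐t z) (s′≐u z)
  glued (join t u) = let s , s≐t = glued t ; s′ , s′≐u = glued u in
                     (λ c → join (s c) (s′ c)) , λ z → ⊎-cong (s≐t z) (s′≐u z)
  glued (dia d t)  = let s , s≐t = glued t in glueDia d s , glue-dia d s s≐t

  pieces : List (Pred (Carrier S))
  pieces = map (λ h → glue (dterm ∘ finToFun h)) (allFin _)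

  pieces-complete : ∀ t → Any (λ A → A ≐ evalAlg S g t) pieces
  pieces-complete t = map⁺ (Any.map (λ { refl → normalised }) (∈-allFin (funToFin h)))
    where
    s : Code → Term k n
    s = proj₁ (glued t)
    h : Code → Fin p
    h = nf ∘ s
    normalised : glue (dterm ∘ finToFun (funToFin h)) ≐ evalAlg S g t
    normalised = ≐-trans (glue-cong (dterm ∘ finToFun (funToFin h)) (dterm ∘ h)
                            λ c → ≐-reflexive (cong (evalAlg D g ∘ dterm) (finToFun-funToFin h c)))
                 (≐-trans (glue-cong (dterm ∘ h) s λ c → proj₂ (dcovers (s c)))
                          (proj₂ (glued t)))

sum-locallyFinite : LEM → {k : ℕ} (I : Frame k) → (∀ d → Irreflexive (Rel I d)) →
                    (F : Carrier I → Frame k) →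
                    LocallyFiniteAlg (DisjSum (Carrier I) F) → LocallyFiniteAlg I → LocallyFiniteAlg (Sum I F)
sum-locallyFinite lem I irr F lfD lfI n g = pieces , pieces-complete
  where open SumLocallyFinite lem I irr F (termCover (DisjSum (Carrier I) F) g lem (lfD n g)) lfI

corollary5p3 : LEM → (k : ℕ) (I : Frame k) → ((d : Fin k) → Irreflexive (Rel I d)) →
    (F : Carrier I → Frame k) →
    LocallyFiniteAlg (DisjSum (Carrier I) F) → LocallyFiniteAlg I →
    LocallyFiniteAlg (Sum I F) × FMP (Sum I F)
corollary5p3 lem k I irr F lfD lfI = sumLF , locallyFinite⇒fmp lem (Sum I F) sumLF
  where
  sumLF : LocallyFiniteAlg (Sum I F)
  sumLF = sum-locallyFinite lem I irr F lfD lfI
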